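{- Let $G$ be an interval graph with a fixed total order $\prec$ on $V(G)$, and let $\sigma$ be the canonical model of $G$. Let $X\subseteq V(G)$ be a clique and let $C_1,\dots,C_s$ be connected components of $G\setminus X$ (not necessarily all of them) such that $N_G(v)\setminus C_i=X$ for every $1\le i\le s$ and every $v\in C_i$. Index them so that $\mathrm{first}_\sigma(C_1)<\mathrm{last}_\sigma(C_1)<\mathrm{first}_\sigma(C_2)<\mathrm{last}_\sigma(C_2)<\dots<\mathrm{first}_\sigma(C_s)<\mathrm{last}_\sigma(C_s)$ (this is possible since the components are pairwise nonadjacent). For each $i$ let $x_i$ be the $\prec$-minimum vertex of $C_i$. Then $x_1\prec x_2\prec\dots\prec x_s$.
   Context: For each vertex $v$ of $G$ ($n$ vertices) introduce events $\mathrm{beg}(v)$, $\mathrm{end}(v)$. An interval model of $G$ is a bijection $\sigma$ from the $2n$ events to $\{1,\dots,2n\}$ with $\sigma(\mathrm{beg}(v))<\sigma(\mathrm{end}(v))$ for all $v$ and, for all $u,v$, $uv\notin E(G)$ iff $\sigma(\mathrm{end}(v))<\sigma(\mathrm{beg}(u))$ or $\sigma(\mathrm{end}(u))<\sigma(\mathrm{beg}(v))$. For $Y\subseteq V(G)$, $\mathrm{first}_\sigma(Y)$ and $\mathrm{last}_\sigma(Y)$ are the smallest and largest positions of events of vertices of $Y$. If $v_1\prec\dots\prec v_n$, the canonical model of $G$ is the model minimizing lexicographically $(\sigma(\mathrm{beg}(v_1)),\dots,\sigma(\mathrm{beg}(v_n)),\sigma(\mathrm{end}(v_n)),\dots,\sigma(\mathrm{end}(v_1)))$.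 -}

module Defs where

open import Data.Nat using (ℕ; zero; suc; _+_; _<_; _≤_)
open import Data.Fin using (Fin; toℕ)
open import Data.Fin.Subset using (Subset; _∈_; _∉_)
open import Data.List using (List; []; _∷_; map; _++_; reverse)
open import Data.List using () renaming (allFin to allFinL)
open import Data.Product using (Σ; ∃; _×_; _,_)
open import Data.Sum using (_⊎_)
open import Relation.Nullary using (¬_)
open import Relation.Binary using (Decidable)
open import Relation.Binary.PropositionalEquality using (_≡_; _≢_)
open import Function.Definitions using (Bijective)
open import Function using (_⇔_)

-- Finite simple graph on vertex set Fin n. The fixed total order ≺ on V(G)
-- is the natural order of Fin n (u ≺ v iff toℕ u < toℕ v).
record Graph (n : ℕ) : Set₁ where
  field
    Adj    : Fin n → Fin n → Set
    adj?   : Decidable Adj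
    sym    : ∀ {u v} → Adj u v → Adj v u
    irrefl : ∀ {u} → ¬ Adj u u
open Graph public

data Event (n : ℕ) : Set where
  beg end : Fin n → Event n

-- Positions are 0-indexed: Fin (n + n) stands for {1,…,2n}.
Positioning : ℕ → Set
Positioning n = Event n → Fin (n + n)

pos : ∀ {n} → Positioning n → Event n → ℕ
pos σ e = toℕ (σ e)

IsModel : ∀ {n} → Graph n → Positioning n → Set
IsModel {n} G σ =
  Bijective _≡_ _≡_ σ ×
  (∀ v → pos σ (beg v) < pos σ (end v)) ×
  (∀ u v → u ≢ v →
     ((¬ Adj G u v) ⇔ (pos σ (end v) < pos σ (beg u) ⊎ pos σ (end u) < pos σ (beg v))))

key : ∀ {n} → Positioning n → List ℕ
key {n} σ = map (λ v → pos σ (beg v)) (allFinL n)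
         ++ reverse (map (λ v → pos σ (end v)) (allFinL n))

data _<lex_ : List ℕ → List ℕ → Set where
  here  : ∀ {a b xs ys} → a < b → (a ∷ xs) <lex (b ∷ ys)
  there : ∀ {a xs ys} → xs <lex ys → (a ∷ xs) <lex (a ∷ ys)
  nil   : ∀ {b ys} → [] <lex (b ∷ ys)

IsCanonicalModel : ∀ {n} → Graph n → Positioning n → Set
IsCanonicalModel G σ = IsModel G σ × (∀ τ → IsModel G τ → ¬ (key τ <lex key σ))

vertexOf : ∀ {n} → Event n → Fin n
vertexOf (beg v) = v
vertexOf (end v) = v

IsFirst : ∀ {n} → Positioning n → Subset n → ℕ → Set
IsFirst σ Y p = (Σ _ λ e → vertexOf e ∈ Y × pos σ e ≡ p) ×
                (∀ e → vertexOf e ∈ Y → p ≤ pos σ e)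

IsLast : ∀ {n} → Positioning n → Subset n → ℕ → Set
IsLast σ Y p = (Σ _ λ e → vertexOf e ∈ Y × pos σ e ≡ p) ×
               (∀ e → vertexOf e ∈ Y → pos σ e ≤ p)

IsClique : ∀ {n} → Graph n → Subset n → Set
IsClique G X = ∀ u v → u ∈ X → v ∈ X → u ≢ v → Adj G u v

data ReachOut {n} (G : Graph n) (X : Subset n) : Fin n → Fin n → Set where
  stay : ∀ {u} → ReachOut G X u u
  step : ∀ {u v w} → Adj G u v → v ∉ X → ReachOut G X v w → ReachOut G X u w

IsComponentOf : ∀ {n} → Graph n → Subset n → Subset n → Set
IsComponentOf {n} G X C =
  (∀ v → v ∈ C → v ∉ X) ×
  (Σ (Fin n) λ v → v ∈ C) ×
  (∀ u v → u ∈ C → v ∈ C → ReachOut G X u v) ×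
  (∀ u w → u ∈ C → w ∉ X → Adj G u w → w ∈ C)

NbhdMinus≡ : ∀ {n} → Graph n → Fin n → Subset n → Subset n → Set
NbhdMinus≡ G v C X = ∀ w → ((Adj G v w × w ∉ C) ⇔ w ∈ X)

IsMinOf : ∀ {n} → Subset n → Fin n → Set
IsMinOf C x = x ∈ C × (∀ w → w ∈ C → toℕ x ≤ toℕ w)

module Submission where

-- Let C, D be components of G ∖ X seeing exactly X outside themselves, with C
-- entirely before D in a model σ (last(C) < first(D) = fD).  Suppose min D ≺ min C.
-- Reorder the events: D's events, in their order, at the moment fD, then all of
-- C's events, everything else unchanged.  Vertices of X begin before fD and end
-- after it, every other vertex lies on one side of fD (beyond all of D if after),
-- and C, D see nothing outside themselves but X; so the new order is again an
-- interval order, and ranking the events by it gives a model τ.  In τ no vertex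
-- outside C begins later and every vertex of D begins earlier, so since every
-- vertex ≺-before min D is outside C, key τ <lex key σ: σ was not canonical.

open import Defs renaming (sym to Adj-sym)
open import Data.Nat using (ℕ; zero; suc; _+_; _<_; _≤_; z≤n; s≤s; s≤s⁻¹; _<?_)
open import Data.Nat.Properties
  using (≤-refl; ≤-reflexive; ≤-trans; <-trans; <-irrefl; <-asym; <-cmp; <⇒≤; <⇒≢; <⇒≱;
         ≮⇒≥; ≤∧≢⇒<; ≤-<-trans; <-≤-trans; n<1+n; 1+n≰n; m≤n⇒m≤1+n; m<n⇒m<1+n;
         m≤n⇒m<n∨m≡n; m≤m+n; +-monoʳ-<; +-cancelˡ-<; +-cancelˡ-≡)
import Data.Fin as Fin
open import Data.Fin using (Fin; toℕ; zero; suc; fromℕ<; punchOut)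
open import Data.Fin.Properties
  using (toℕ<n; toℕ-injective; toℕ-fromℕ<; punchOut-injective; injective⇒≤; any?)
open import Data.Fin.Subset using (Subset; _∈_; _∉_)
open import Data.Fin.Subset.Properties using (_∈?_)
open import Data.List using (List; _++_; reverse; map; tabulate; allFin)
open import Data.List.Properties using (map-tabulate)
open import Data.Empty using (⊥-elim)
open import Data.Product using (_×_; _,_; proj₁; proj₂)
open import Data.Product.Relation.Binary.Lex.Strict using (×-Lex; ×-transitive; ×-compare)
open import Data.Product.Relation.Binary.Pointwise.NonDependent using (≡×≡⇒≡; ≡⇒≡×≡)
open import Data.Sum using (_⊎_; inj₁; inj₂; [_,_]′) renaming (swap to ⊎-swap)
open import Data.Sum.Function.Propositional using (_⊎-⇔_)
open import Function using (id; _∘_; _⇔_; mk⇔; Equivalence)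
open import Function.Construct.Composition using (_⇔-∘_) renaming (bijective to ∘-bijective)
open import Function.Construct.Symmetry using (⇔-sym)
open import Function.Definitions using (Injective; Surjective; Bijective)
open import Relation.Nullary using (¬_; yes; no; contradiction)
open import Relation.Unary using (Decidable)
open import Relation.Binary using (Transitive; Trichotomous; tri<; tri≈; tri>)
open import Relation.Binary.Consequences using (tri⇒irr; tri⇒dec<)
open import Relation.Binary.PropositionalEquality
  using (_≡_; _≢_; refl; sym; trans; cong; subst; subst₂; isEquivalence; resp₂; module ≡-Reasoning)

count : ∀ {m} {P : Fin m → Set} → Decidable P → ℕ
count {zero}  P? = 0
count {suc m} P? with P? zero
... | yes _ = suc (count (P? ∘ suc))
... | no  _ = count (P? ∘ suc)

count-mono : ∀ {m} {P Q : Fin m → Set} (P? : Decidable P) (Q? : Decidable Q) →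
             (∀ q → P q → Q q) → count P? ≤ count Q?
count-mono {zero}  P? Q? P⇒Q = z≤n
count-mono {suc m} P? Q? P⇒Q with P? zero | Q? zero
... | yes _  | yes _  = s≤s (count-mono (P? ∘ suc) (Q? ∘ suc) (P⇒Q ∘ suc))
... | yes P0 | no ¬Q0 = contradiction (P⇒Q zero P0) ¬Q0
... | no _   | yes _  = m≤n⇒m≤1+n (count-mono (P? ∘ suc) (Q? ∘ suc) (P⇒Q ∘ suc))
... | no _   | no _   = count-mono (P? ∘ suc) (Q? ∘ suc) (P⇒Q ∘ suc)

count-strict : ∀ {m} {P Q : Fin m → Set} (P? : Decidable P) (Q? : Decidable Q) →
               (∀ q → P q → Q q) → ∀ q₀ → Q q₀ → ¬ P q₀ → count P? < count Q?
count-strict {suc m} P? Q? P⇒Q zero Qq₀ ¬Pq₀ with P? zero | Q? zero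
... | yes P0 | _      = contradiction P0 ¬Pq₀
... | no _   | yes _  = s≤s (count-mono (P? ∘ suc) (Q? ∘ suc) (P⇒Q ∘ suc))
... | no _   | no ¬Q0 = contradiction Qq₀ ¬Q0
count-strict {suc m} P? Q? P⇒Q (suc q₀) Qq₀ ¬Pq₀ with P? zero | Q? zero
... | yes _  | yes _  = s≤s (count-strict (P? ∘ suc) (Q? ∘ suc) (P⇒Q ∘ suc) q₀ Qq₀ ¬Pq₀)
... | yes P0 | no ¬Q0 = contradiction (P⇒Q zero P0) ¬Q0
... | no _   | yes _  = m<n⇒m<1+n (count-strict (P? ∘ suc) (Q? ∘ suc) (P⇒Q ∘ suc) q₀ Qq₀ ¬Pq₀)
... | no _   | no _   = count-strict (P? ∘ suc) (Q? ∘ suc) (P⇒Q ∘ suc) q₀ Qq₀ ¬Pq₀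

count-bounded : ∀ {m} {P : Fin m → Set} (P? : Decidable P) k →
                (∀ q → P q → toℕ q < k) → count P? ≤ k
count-bounded {zero}  P? k below = z≤n
count-bounded {suc m} P? k below with P? zero
... | no _ = count-bounded (P? ∘ suc) k (λ q Pq → <-trans (n<1+n (toℕ q)) (below (suc q) Pq))
... | yes P0 with below zero P0
...   | s≤s _ = s≤s (count-bounded (P? ∘ suc) _ (λ q Pq → s≤s⁻¹ (below (suc q) Pq)))

count-<-bound : ∀ {m} {P : Fin m → Set} (P? : Decidable P) k →
                (∀ q → P q → toℕ q < k) → ∀ q₀ → toℕ q₀ < k → ¬ P q₀ → count P? < k
count-<-bound {m} P? k below q₀ q₀<k ¬Pq₀ =
  <-≤-trans (count-strict P? (λ q → toℕ q <? k) below q₀ q₀<k ¬Pq₀)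
            (count-bounded {m} (λ q → toℕ q <? k) k (λ _ q<k → q<k))

injective⇒surjective : ∀ {m} (f : Fin m → Fin m) → Injective _≡_ _≡_ f → Surjective _≡_ _≡_ f
injective⇒surjective {suc m} f f-inj y with any? (λ x → f x Fin.≟ y)
... | yes (x , fx≡y) = x , λ { refl → fx≡y }
... | no ∄x = contradiction (injective⇒≤ {f = f-without-y} f-without-y-inj) 1+n≰n
  where
  y≢f : ∀ x → y ≢ f x
  y≢f x y≡fx = ∄x (x , sym y≡fx)
  f-without-y : Fin (suc m) → Fin m
  f-without-y x = punchOut (y≢f x)
  f-without-y-inj : Injective _≡_ _≡_ f-without-y
  f-without-y-inj eq = f-inj (punchOut-injective (y≢f _) (y≢f _) eq)

module Ranking {A : Set} (_≺_ : A → A → Set)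
               (≺-trans : Transitive _≺_) (≺-cmp : Trichotomous _≡_ _≺_)
               {m : ℕ} (K : Fin m → A) (K-inj : Injective _≡_ _≡_ K) where

  private
    ≺-irrefl : ∀ {a} → ¬ (a ≺ a)
    ≺-irrefl = tri⇒irr ≺-cmp refl

  rank : Fin m → ℕ
  rank p = count (λ q → tri⇒dec< ≺-cmp (K q) (K p))

  rank-≤ : ∀ p k → (∀ q → K q ≺ K p → toℕ q < k) → rank p ≤ k
  rank-≤ p = count-bounded _

  rank-< : ∀ p k → (∀ q → K q ≺ K p → toℕ q < k) →
           ∀ q₀ → toℕ q₀ < k → ¬ (K q₀ ≺ K p) → rank p < k
  rank-< p = count-<-bound _

  rank<m : ∀ p → rank p < m
  rank<m p = rank-< p m (λ q _ → toℕ<n q) p (toℕ<n p) ≺-irrefl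

  rank-mono : ∀ {p q} → K p ≺ K q → rank p < rank q
  rank-mono {p} {q} Kp≺Kq =
    count-strict _ _ (λ r Kr≺Kp → ≺-trans Kr≺Kp Kp≺Kq) p Kp≺Kq ≺-irrefl

  rank-reflects : ∀ {p q} → rank p < rank q → K p ≺ K q
  rank-reflects {p} {q} lt with ≺-cmp (K p) (K q)
  ... | tri< Kp≺Kq _ _ = Kp≺Kq
  ... | tri≈ _ Kp≡Kq _ = contradiction (cong rank (K-inj Kp≡Kq)) (<⇒≢ lt)
  ... | tri> _ _ Kq≺Kp = contradiction (rank-mono Kq≺Kp) (<-asym lt)

  rank-injective : ∀ {p q} → rank p ≡ rank q → p ≡ q
  rank-injective {p} {q} eq with ≺-cmp (K p) (K q)
  ... | tri< Kp≺Kq _ _ = contradiction eq (<⇒≢ (rank-mono Kp≺Kq))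
  ... | tri≈ _ Kp≡Kq _ = K-inj Kp≡Kq
  ... | tri> _ _ Kq≺Kp = contradiction (sym eq) (<⇒≢ (rank-mono Kq≺Kp))

  sort : Fin m → Fin m
  sort p = fromℕ< (rank<m p)

  toℕ-sort : ∀ p → toℕ (sort p) ≡ rank p
  toℕ-sort p = toℕ-fromℕ< (rank<m p)

  sort-bijective : Bijective _≡_ _≡_ sort
  sort-bijective = sort-injective , injective⇒surjective sort sort-injective
    where
    open ≡-Reasoning
    sort-injective : Injective _≡_ _≡_ sort
    sort-injective {p} {q} eq = rank-injective (begin
      rank p         ≡⟨ sym (toℕ-sort p) ⟩
      toℕ (sort p)   ≡⟨ cong toℕ eq ⟩
      toℕ (sort q)   ≡⟨ toℕ-sort q ⟩
      rank q         ∎)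

Disjoint : ∀ {n} {A : Set} → (A → A → Set) → (Event n → A) → Fin n → Fin n → Set
Disjoint _≺_ κ u v = κ (end v) ≺ κ (beg u) ⊎ κ (end u) ≺ κ (beg v)

IsIntervalOrder : ∀ {n} {A : Set} → Graph n → (A → A → Set) → (Event n → A) → Set
IsIntervalOrder G _≺_ κ =
  (∀ v → κ (beg v) ≺ κ (end v)) ×
  (∀ u v → u ≢ v → (¬ Adj G u v) ⇔ Disjoint _≺_ κ u v)

Disjoint-⇔ : ∀ {n} {A B : Set} (_≺_ : A → A → Set) (_⊏_ : B → B → Set)
               (κ : Event n → A) (μ : Event n → B) →
             (∀ e e' → κ e ≺ κ e' ⇔ μ e ⊏ μ e') →
             ∀ u v → Disjoint _≺_ κ u v ⇔ Disjoint _⊏_ μ u v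
Disjoint-⇔ _ _ _ _ same u v = same _ _ ⊎-⇔ same _ _

-- Relabelling a model σ along an injective event order κ: the positioning τ
-- places the events in κ-order, so τ is a model whenever κ is an interval order.
module Relabel {n} {A : Set} (_≺_ : A → A → Set)
               (≺-trans : Transitive _≺_) (≺-cmp : Trichotomous _≡_ _≺_)
               (σ : Positioning n) (σ-bij : Bijective _≡_ _≡_ σ)
               (κ : Event n → A) (κ-inj : Injective _≡_ _≡_ κ) where

  σ⁻¹ : Fin (n + n) → Event n
  σ⁻¹ q = proj₁ (proj₂ σ-bij q)

  σ∘σ⁻¹ : ∀ q → σ (σ⁻¹ q) ≡ q
  σ∘σ⁻¹ q = proj₂ (proj₂ σ-bij q) refl

  σ⁻¹∘σ : ∀ e → σ⁻¹ (σ e) ≡ e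
  σ⁻¹∘σ e = proj₁ σ-bij (σ∘σ⁻¹ (σ e))

  K : Fin (n + n) → A
  K = κ ∘ σ⁻¹

  K∘σ : ∀ e → K (σ e) ≡ κ e
  K∘σ e = cong κ (σ⁻¹∘σ e)

  K-inj : Injective _≡_ _≡_ K
  K-inj {p} {q} Kp≡Kq = begin
    p           ≡⟨ sym (σ∘σ⁻¹ p) ⟩
    σ (σ⁻¹ p)   ≡⟨ cong σ (κ-inj Kp≡Kq) ⟩
    σ (σ⁻¹ q)   ≡⟨ σ∘σ⁻¹ q ⟩
    q           ∎
    where open ≡-Reasoning

  open Ranking _≺_ ≺-trans ≺-cmp K K-inj

  τ : Positioning n
  τ = sort ∘ σ

  pos-τ : ∀ e → pos τ e ≡ rank (σ e)
  pos-τ e = toℕ-sort (σ e)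

  τ-order : ∀ e e' → κ e ≺ κ e' ⇔ pos τ e < pos τ e'
  τ-order e e' = mk⇔
    (λ κe≺κe' → subst₂ _<_ (sym (pos-τ e)) (sym (pos-τ e'))
                  (rank-mono (subst₂ _≺_ (sym (K∘σ e)) (sym (K∘σ e')) κe≺κe')))
    (λ τe<τe' → subst₂ _≺_ (K∘σ e) (K∘σ e')
                  (rank-reflects (subst₂ _<_ (pos-τ e) (pos-τ e') τe<τe')))

  τ-model : ∀ G → IsIntervalOrder G _≺_ κ → IsModel G τ
  τ-model G (beg≺end , criterion) =
    ∘-bijective _≡_ _≡_ _≡_ σ-bij sort-bijective ,
    (λ v → Equivalence.to (τ-order _ _) (beg≺end v)) ,
    (λ u v u≢v → Disjoint-⇔ _≺_ _<_ κ (pos τ) τ-order u v ⇔-∘ criterion u v u≢v)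

  private
    below-σ : ∀ e k → (∀ e' → κ e' ≺ κ e → pos σ e' < k) → ∀ q → K q ≺ K (σ e) → toℕ q < k
    below-σ e k below q Kq≺Ke =
      subst (_< k) (cong toℕ (σ∘σ⁻¹ q)) (below (σ⁻¹ q) (subst (K q ≺_) (K∘σ e) Kq≺Ke))

  pos-τ-≤ : ∀ e k → (∀ e' → κ e' ≺ κ e → pos σ e' < k) → pos τ e ≤ k
  pos-τ-≤ e k below = subst (_≤ k) (sym (pos-τ e)) (rank-≤ (σ e) k (below-σ e k below))

  pos-τ-< : ∀ e k → (∀ e' → κ e' ≺ κ e → pos σ e' < k) →
            ∀ e₀ → pos σ e₀ < k → ¬ (κ e₀ ≺ κ e) → pos τ e < k
  pos-τ-< e k below e₀ e₀<k e₀⊀e =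
    subst (_< k) (sym (pos-τ e))
      (rank-< (σ e) k (below-σ e k below) (σ e₀) e₀<k (e₀⊀e ∘ subst₂ _≺_ (K∘σ e₀) (K∘σ e)))

tabulate-<lex : ∀ {k} (g h : Fin k → ℕ) (xs ys : List ℕ) (m : Fin k) →
                (∀ w → toℕ w < toℕ m → g w ≤ h w) → g m < h m →
                (tabulate g ++ xs) <lex (tabulate h ++ ys)
tabulate-<lex g h xs ys zero    _       gm<hm = here gm<hm
tabulate-<lex g h xs ys (suc m) earlier gm<hm with m≤n⇒m<n∨m≡n (earlier zero (s≤s z≤n))
... | inj₁ g0<h0 = here g0<h0
... | inj₂ g0≡h0 rewrite g0≡h0 =
  there (tabulate-<lex (g ∘ suc) (h ∘ suc) xs ys m (λ w w<m → earlier (suc w) (s≤s w<m)) gm<hm)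

key-<lex : ∀ {n} (τ σ : Positioning n) (m : Fin n) →
           (∀ w → toℕ w < toℕ m → pos τ (beg w) ≤ pos σ (beg w)) →
           pos τ (beg m) < pos σ (beg m) → key τ <lex key σ
key-<lex {n} τ σ m earlier at-m =
  subst₂ _<lex_ (sym (key-tabulate τ)) (sym (key-tabulate σ))
    (tabulate-<lex _ _ _ _ m earlier at-m)
  where
  ends : Positioning n → List ℕ
  ends ς = reverse (map (λ v → pos ς (end v)) (allFin n))
  key-tabulate : ∀ ς → key ς ≡ tabulate (λ v → pos ς (beg v)) ++ ends ς
  key-tabulate ς = cong (_++ ends ς) (map-tabulate id (λ v → pos ς (beg v)))

-- The lexicographic order on ℕ × ℕ, in which the swapped model is first described.
_<ₗ_ : ℕ × ℕ → ℕ × ℕ → Set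
_<ₗ_ = ×-Lex _≡_ _<_ _<_

<ₗ-trans : Transitive _<ₗ_
<ₗ-trans = ×-transitive {_<₂_ = _<_} isEquivalence (resp₂ _<_) <-trans <-trans

<ₗ-cmp : Trichotomous _≡_ _<ₗ_
<ₗ-cmp x y with ×-compare sym <-cmp <-cmp x y
... | tri< x<y x≢y x≯y = tri< x<y (x≢y ∘ ≡⇒≡×≡) x≯y
... | tri≈ x≮y x≡y x≯y = tri≈ x≮y (≡×≡⇒≡ x≡y) x≯y
... | tri> x≮y x≢y x>y = tri> x≮y (x≢y ∘ ≡⇒≡×≡) x>y

<⇔<ₗ-second : ∀ {c p q} → p < q ⇔ (c , p) <ₗ (c , q)
<⇔<ₗ-second = mk⇔ (λ p<q → inj₂ (refl , p<q))
  λ { (inj₁ c<c) → contradiction c<c (<-irrefl refl) ; (inj₂ (_ , p<q)) → p<q }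

<⇔<ₗ-first : ∀ {p q} → p < q ⇔ (p , 0) <ₗ (q , 0)
<⇔<ₗ-first = mk⇔ inj₁ λ { (inj₁ p<q) → p<q ; (inj₂ (_ , ())) }

nonadjacent⇔∉X : ∀ {n} (G : Graph n) {v : Fin n} {K X : Subset n} →
                 NbhdMinus≡ G v K X → ∀ {w} → w ∉ K → (¬ Adj G v w) ⇔ w ∉ X
nonadjacent⇔∉X G nbhd {w} w∉K = mk⇔
  (λ ¬adj w∈X → ¬adj (proj₁ (Equivalence.from (nbhd w) w∈X)))
  (λ w∉X adj → w∉X (Equivalence.to (nbhd w) (adj , w∉K)))

criterion-sym : ∀ {n} (G : Graph n) {u v : Fin n} {P Q : Set} →
                (¬ Adj G v u) ⇔ (P ⊎ Q) → (¬ Adj G u v) ⇔ (Q ⊎ P)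
criterion-sym G criterion = mk⇔
  (λ ¬uv → ⊎-swap (Equivalence.to criterion (¬uv ∘ Adj-sym G)))
  (λ qp uv → Equivalence.from criterion (⊎-swap qp) (Adj-sym G uv))

-- Two components C, D of G ∖ X, each seeing exactly X outside itself, with C
-- entirely before D in a model σ.  The swap moves C to just after D.
module Swap {n} (G : Graph n) (σ : Positioning n) (σ-model : IsModel G σ)
            (X C D : Subset n)
            (C-comp : IsComponentOf G X C) (D-comp : IsComponentOf G X D)
            (C-nbhd : ∀ v → v ∈ C → NbhdMinus≡ G v C X)
            (D-nbhd : ∀ v → v ∈ D → NbhdMinus≡ G v D X)
            {lC fD : ℕ} (C-last : IsLast σ C lC) (D-first : IsFirst σ D fD) (lC<fD : lC < fD)
            where

  σ-bij : Bijective _≡_ _≡_ σ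
  σ-bij = proj₁ σ-model

  pb pe : Fin n → ℕ
  pb v = pos σ (beg v)
  pe v = pos σ (end v)

  beg<end : ∀ v → pb v < pe v
  beg<end = proj₁ (proj₂ σ-model)

  σ-criterion : ∀ u v → u ≢ v → (¬ Adj G u v) ⇔ Disjoint _<_ (pos σ) u v
  σ-criterion = proj₂ (proj₂ σ-model)

  pos-injective : ∀ {e e'} → pos σ e ≡ pos σ e' → e ≡ e'
  pos-injective eq = proj₁ σ-bij (toℕ-injective eq)

  below-shift : ∀ e p → pos σ e < n + n + p
  below-shift e p = <-≤-trans (toℕ<n (σ e)) (m≤m+n (n + n) p)

  ≤end : ∀ e → pos σ e ≤ pe (vertexOf e)
  ≤end (beg v) = <⇒≤ (beg<end v)
  ≤end (end v) = ≤-refl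

  adjacent⇒¬Disjoint : ∀ {u v} → u ≢ v → Adj G u v → ¬ Disjoint _<_ (pos σ) u v
  adjacent⇒¬Disjoint {u} {v} u≢v adj disjoint = Equivalence.from (σ-criterion u v u≢v) disjoint adj

  ¬Disjoint⇒adjacent : ∀ {u v} → u ≢ v → ¬ Disjoint _<_ (pos σ) u v → Adj G u v
  ¬Disjoint⇒adjacent {u} {v} u≢v ¬disjoint with adj? G u v
  ... | yes adj = adj
  ... | no ¬adj = contradiction (Equivalence.to (σ-criterion u v u≢v) ¬adj) ¬disjoint

  C-before-D : ∀ e e' → vertexOf e ∈ C → vertexOf e' ∈ D → pos σ e < pos σ e'
  C-before-D e e' e∈C e'∈D =
    ≤-<-trans (proj₂ C-last e e∈C) (<-≤-trans lC<fD (proj₂ D-first e' e'∈D))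

  C∩D≡∅ : ∀ {v} → v ∈ C → v ∉ D
  C∩D≡∅ {v} v∈C v∈D = <-irrefl refl (C-before-D (beg v) (beg v) v∈C v∈D)

  c₀ : Fin n
  c₀ = proj₁ (proj₁ (proj₂ C-comp))

  c₀∈C : c₀ ∈ C
  c₀∈C = proj₂ (proj₁ (proj₂ C-comp))

  d₀ : Fin n
  d₀ = vertexOf (proj₁ (proj₁ D-first))

  d₀∈D : d₀ ∈ D
  d₀∈D = proj₁ (proj₂ (proj₁ D-first))

  pb-d₀ : pb d₀ ≡ fD
  pb-d₀ with proj₁ D-first
  ... | beg v , _   , at-fD = at-fD
  ... | end v , v∈D , at-fD =
    contradiction (<-≤-trans (beg<end v) (≤-trans (≤-reflexive at-fD) (proj₂ D-first (beg v) v∈D)))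
                  (<-irrefl refl)

  at-fD : ∀ e → pos σ e ≡ fD → vertexOf e ∈ D
  at-fD e e-at-fD with pos-injective {e} {beg d₀} (trans e-at-fD (sym pb-d₀))
  ... | refl = d₀∈D

  meets-X : ∀ {K v x} → IsComponentOf G X K → v ∈ K → NbhdMinus≡ G v K X → x ∈ X →
            pb x ≤ pe v × pb v ≤ pe x
  meets-X {K} {v} {x} K-comp v∈K nbhd x∈X =
    ≮⇒≥ (adjacent⇒¬Disjoint v≢x vx ∘ inj₂) , ≮⇒≥ (adjacent⇒¬Disjoint v≢x vx ∘ inj₁)
    where
    vx : Adj G v x
    vx = proj₁ (Equivalence.from (nbhd x) x∈X)
    v≢x : v ≢ x
    v≢x refl = proj₁ K-comp v v∈K x∈X

  -- Vertices of X begin before fD (they meet C) and end after it (they meet D).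
  X-straddles : ∀ {x} → x ∈ X → pb x < fD × fD ≤ pe x
  X-straddles x∈X =
    ≤-<-trans (proj₁ (meets-X C-comp c₀∈C (C-nbhd c₀ c₀∈C) x∈X))
              (≤-<-trans (proj₂ C-last (end c₀) c₀∈C) lC<fD) ,
    ≤-trans (≤-reflexive (sym pb-d₀)) (proj₂ (meets-X D-comp d₀∈D (D-nbhd d₀ d₀∈D) x∈X))

  -- Any other vertex outside D lies entirely on one side of fD: otherwise it
  -- would meet d₀ and hence belong to X.
  avoids-fD : ∀ v → v ∉ D → v ∉ X → pe v < fD ⊎ fD < pb v
  avoids-fD v v∉D v∉X with pb v <? fD
  ... | no pb≮fD = inj₂ (≤∧≢⇒< (≮⇒≥ pb≮fD) (λ fD≡pb → v∉D (at-fD (beg v) (sym fD≡pb))))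
  ... | yes pb<fD with pe v <? fD
  ...   | yes pe<fD = inj₁ pe<fD
  ...   | no pe≮fD = contradiction (Equivalence.to (D-nbhd d₀ d₀∈D v) (d₀v , v∉D)) v∉X
    where
    d₀≢v : d₀ ≢ v
    d₀≢v refl = v∉D d₀∈D
    d₀v : Adj G d₀ v
    d₀v = ¬Disjoint⇒adjacent d₀≢v
      [ (λ pe<pbd₀ → pe≮fD (subst (pe v <_) pb-d₀ pe<pbd₀))
      , (λ ped₀<pb → <-asym ped₀<pb (<-trans pb<fD (subst (_< pe d₀) pb-d₀ (beg<end d₀)))) ]′

  -- Such a vertex beginning after fD begins after all of D has ended: walking
  -- through the connected set D from d₀, no vertex of D can reach past it.
  after-D : ∀ v → v ∉ D → v ∉ X → fD < pb v → ∀ w → w ∈ D → pe w < pb v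
  after-D v v∉D v∉X fD<pb w w∈D =
    walk (proj₁ (proj₂ (proj₂ D-comp)) d₀ w d₀∈D w∈D) d₀∈D d₀-before-v
    where
    separated : ∀ {u} → u ∈ D → Disjoint _<_ (pos σ) u v
    separated {u} u∈D = Equivalence.to (σ-criterion u v (λ { refl → v∉D u∈D }))
                                       (Equivalence.from (nonadjacent⇔∉X G (D-nbhd u u∈D) v∉D) v∉X)
    d₀-before-v : pe d₀ < pb v
    d₀-before-v = [ (λ pe<pbd₀ → contradiction (<-trans pe<pbd₀ (subst (_< pb v) (sym pb-d₀) fD<pb))
                                               (<-asym (beg<end v)))
                  , (λ ped₀<pb → ped₀<pb) ]′ (separated d₀∈D)
    walk : ∀ {u w} → ReachOut G X u w → u ∈ D → pe u < pb v → pe w < pb v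
    walk stay _ pe<pb = pe<pb
    walk (step {v = u'} adj u'∉X rest) u∈D pe<pb = walk rest u'∈D
      ([ (λ pev<pbu' → contradiction (<-trans pev<pbu' (≤-<-trans pbu'≤peu (<-trans pe<pb (beg<end v))))
                                    (<-irrefl refl))
       , (λ peu'<pb → peu'<pb) ]′ (separated u'∈D))
      where
      u'∈D : u' ∈ D
      u'∈D = proj₂ (proj₂ (proj₂ D-comp)) _ u' u∈D u'∉X adj
      pbu'≤peu : pb u' ≤ pe _
      pbu'≤peu = ≮⇒≥ (adjacent⇒¬Disjoint (λ { refl → irrefl G adj }) adj ∘ inj₂)

  data Place (v : Fin n) : Set where
    inD       : v ∈ D → Place v
    inC       : v ∈ C → Place v
    elsewhere : v ∉ D → v ∉ C → Place v

  place : ∀ v → Place v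
  place v with v ∈? D | v ∈? C
  ... | yes v∈D | _       = inD v∈D
  ... | no  v∉D | yes v∈C = inC v∈C
  ... | no  v∉D | no  v∉C = elsewhere v∉D v∉C

  -- The swapped order: the events of D keep their order at the moment fD, the
  -- events of C follow them, and all other events stay where they are.
  slot : ∀ {v} → Place v → ℕ → ℕ × ℕ
  slot (inD _)         p = (fD , p)
  slot (inC _)         p = (fD , n + n + p)
  slot (elsewhere _ _) p = (p , 0)

  κ : Event n → ℕ × ℕ
  κ e = slot (place (vertexOf e)) (pos σ e)

  slot-embedding : ∀ {v} (π : Place v) {p q} → p < q ⇔ slot π p <ₗ slot π q
  slot-embedding (inD _)         = <⇔<ₗ-second
  slot-embedding (inC _)         = <⇔<ₗ-second ⇔-∘ mk⇔ (+-monoʳ-< (n + n)) (+-cancelˡ-< (n + n) _ _)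
  slot-embedding (elsewhere _ _) = <⇔<ₗ-first

  κ-injective : Injective _≡_ _≡_ κ
  κ-injective {e} {e'} = pos-injective ∘ same-pos
    where
    same-pos : κ e ≡ κ e' → pos σ e ≡ pos σ e'
    same-pos with place (vertexOf e) | place (vertexOf e')
    ... | inD _           | inD _           = cong proj₂
    ... | inC _           | inC _           = +-cancelˡ-≡ (n + n) _ _ ∘ cong proj₂
    ... | elsewhere _ _   | elsewhere _ _   = cong proj₁
    ... | inD _           | inC _           = λ eq → contradiction (cong proj₂ eq) (<⇒≢ (below-shift e _))
    ... | inC _           | inD _           = λ eq → contradiction (sym (cong proj₂ eq)) (<⇒≢ (below-shift e' _))
    ... | inD _           | elsewhere e'∉D _ = λ eq → contradiction (at-fD e' (sym (cong proj₁ eq))) e'∉D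
    ... | inC _           | elsewhere e'∉D _ = λ eq → contradiction (at-fD e' (sym (cong proj₁ eq))) e'∉D
    ... | elsewhere e∉D _ | inD _           = λ eq → contradiction (at-fD e (cong proj₁ eq)) e∉D
    ... | elsewhere e∉D _ | inC _           = λ eq → contradiction (at-fD e (cong proj₁ eq)) e∉D

  κ-beg<end : ∀ v → κ (beg v) <ₗ κ (end v)
  κ-beg<end v = Equivalence.to (slot-embedding (place v)) (beg<end v)

  criterion-within : ∀ (f : ℕ → ℕ × ℕ) → (∀ {p q} → p < q ⇔ f p <ₗ f q) →
                     ∀ u v → u ≢ v → (¬ Adj G u v) ⇔ Disjoint _<ₗ_ (f ∘ pos σ) u v
  criterion-within f f-embedding u v u≢v =
    Disjoint-⇔ _<_ _<ₗ_ (pos σ) (f ∘ pos σ) (λ _ _ → f-embedding) u v ⇔-∘ σ-criterion u v u≢v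

  D-C-criterion : ∀ {u v} → u ∈ D → v ∈ C →
                  (¬ Adj G u v) ⇔ ((fD , n + n + pe v) <ₗ (fD , pb u) ⊎ (fD , pe u) <ₗ (fD , n + n + pb v))
  D-C-criterion {u} {v} u∈D v∈C = mk⇔
    (λ _ → inj₂ (inj₂ (refl , below-shift (end u) _)))
    (λ _ adj → proj₁ C-comp v v∈C (Equivalence.to (D-nbhd u u∈D v) (adj , C∩D≡∅ v∈C)))

  misses-block⇔∉X : ∀ {v} → v ∉ D → ∀ s₁ s₂ →
                    ((pe v , 0) <ₗ (fD , s₁) ⊎ (fD , s₂) <ₗ (pb v , 0)) ⇔ v ∉ X
  misses-block⇔∉X {v} v∉D s₁ s₂ = mk⇔ misses⇒∉X ∉X⇒misses
    where
    misses⇒∉X : (pe v , 0) <ₗ (fD , s₁) ⊎ (fD , s₂) <ₗ (pb v , 0) → v ∉ X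
    misses⇒∉X (inj₁ (inj₁ pe<fD))       v∈X = <⇒≱ pe<fD (proj₂ (X-straddles v∈X))
    misses⇒∉X (inj₁ (inj₂ (pe≡fD , _))) _   = v∉D (at-fD (end v) pe≡fD)
    misses⇒∉X (inj₂ (inj₁ fD<pb))       v∈X = <-asym fD<pb (proj₁ (X-straddles v∈X))
    misses⇒∉X (inj₂ (inj₂ (fD≡pb , _))) _   = v∉D (at-fD (beg v) (sym fD≡pb))
    ∉X⇒misses : v ∉ X → (pe v , 0) <ₗ (fD , s₁) ⊎ (fD , s₂) <ₗ (pb v , 0)
    ∉X⇒misses v∉X = [ inj₁ ∘ inj₁ , inj₂ ∘ inj₁ ]′ (avoids-fD v v∉D v∉X)

  -- Pairs from C or D and the rest: both sides say "v ∉ X".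
  block-criterion : ∀ {u v K} → NbhdMinus≡ G u K X → v ∉ K → v ∉ D → ∀ s₁ s₂ →
                    (¬ Adj G u v) ⇔ ((pe v , 0) <ₗ (fD , s₁) ⊎ (fD , s₂) <ₗ (pb v , 0))
  block-criterion nbhd v∉K v∉D s₁ s₂ =
    ⇔-sym (misses-block⇔∉X v∉D s₁ s₂) ⇔-∘ nonadjacent⇔∉X G nbhd v∉K

  κ-criterion : ∀ u v → u ≢ v → (¬ Adj G u v) ⇔ Disjoint _<ₗ_ κ u v
  κ-criterion u v u≢v with place u | place v
  ... | inD h           | inD _           = criterion-within (slot (inD h)) (slot-embedding (inD h)) u v u≢v
  ... | inC h           | inC _           = criterion-within (slot (inC h)) (slot-embedding (inC h)) u v u≢v
  ... | elsewhere a b   | elsewhere _ _   =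
    criterion-within (slot (elsewhere a b)) (slot-embedding (elsewhere a b)) u v u≢v
  ... | inD u∈D         | inC v∈C         = D-C-criterion u∈D v∈C
  ... | inC u∈C         | inD v∈D         = criterion-sym G (D-C-criterion v∈D u∈C)
  ... | inD u∈D         | elsewhere v∉D _ = block-criterion (D-nbhd u u∈D) v∉D v∉D _ _
  ... | inC u∈C         | elsewhere v∉D v∉C = block-criterion (C-nbhd u u∈C) v∉C v∉D _ _
  ... | elsewhere u∉D _ | inD v∈D         = criterion-sym G (block-criterion (D-nbhd v v∈D) u∉D u∉D _ _)
  ... | elsewhere u∉D u∉C | inC v∈C       = criterion-sym G (block-criterion (C-nbhd v v∈C) u∉C u∉D _ _)

  open Relabel _<ₗ_ <ₗ-trans <ₗ-cmp σ σ-bij κ κ-injective using (τ; τ-model; pos-τ-≤; pos-τ-<)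

  τ-is-model : IsModel G τ
  τ-is-model = τ-model G (κ-beg<end , κ-criterion)

  κ-before-beg : ∀ w → w ∉ C → ∀ e → κ e <ₗ κ (beg w) → pos σ e < pb w
  κ-before-beg w w∉C e with place w | place (vertexOf e)
  ... | inC w∈C         | _               = ⊥-elim (w∉C w∈C)
  ... | inD _           | inD _           = Equivalence.from <⇔<ₗ-second
  ... | inD _           | inC _           = λ e≺w → contradiction (Equivalence.from <⇔<ₗ-second e≺w)
                                                                (<-asym (below-shift (beg w) _))
  ... | inD w∈D         | elsewhere e∉D _ = λ
    { (inj₁ e<fD)         → <-≤-trans e<fD (proj₂ D-first (beg w) w∈D)
    ; (inj₂ (e≡fD , _)) → ⊥-elim (e∉D (at-fD e e≡fD)) }
  ... | elsewhere _ _   | elsewhere _ _   = Equivalence.from <⇔<ₗ-first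
  ... | elsewhere _ _   | inC e∈C         = λ
    { (inj₁ fD<pb)  → ≤-<-trans (proj₂ C-last e e∈C) (<-trans lC<fD fD<pb)
    ; (inj₂ (_ , ())) }
  ... | elsewhere w∉D _ | inD e∈D         = λ
    { (inj₁ fD<pb)  → ≤-<-trans (≤end e)
                        (after-D w w∉D (λ w∈X → <-asym fD<pb (proj₁ (X-straddles w∈X))) fD<pb _ e∈D)
    ; (inj₂ (_ , ())) }

  κ-D-before-C : ∀ {c d} → c ∈ C → d ∈ D → ¬ (κ (beg c) <ₗ κ (beg d))
  κ-D-before-C {c} {d} c∈C d∈D with place c | place d
  ... | inC _           | inD _           = λ c≺d → <-asym (Equivalence.from <⇔<ₗ-second c≺d)
                                                         (below-shift (beg d) _)
  ... | inD c∈D         | _               = ⊥-elim (C∩D≡∅ c∈C c∈D)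
  ... | elsewhere _ c∉C | _               = ⊥-elim (c∉C c∈C)
  ... | inC _           | inC d∈C         = ⊥-elim (C∩D≡∅ d∈C d∈D)
  ... | inC _           | elsewhere d∉D _ = ⊥-elim (d∉D d∈D)

  τ-beg-≤ : ∀ w → w ∉ C → pos τ (beg w) ≤ pb w
  τ-beg-≤ w w∉C = pos-τ-≤ (beg w) (pb w) (κ-before-beg w w∉C)

  τ-beg-< : ∀ d → d ∈ D → pos τ (beg d) < pb d
  τ-beg-< d d∈D =
    pos-τ-< (beg d) (pb d) (κ-before-beg d (λ d∈C → C∩D≡∅ d∈C d∈D))
            (beg c₀) (C-before-D (beg c₀) (beg d) c₀∈C d∈D) (κ-D-before-C c₀∈C d∈D)

  -- In a lexicographically minimal model, min C ≺ min D: otherwise no vertex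
  -- before min D lies in C, and τ would be a smaller model.
  min-C≺min-D : (∀ τ' → IsModel G τ' → ¬ (key τ' <lex key σ)) →
                ∀ {xC xD} → IsMinOf C xC → IsMinOf D xD → toℕ xC < toℕ xD
  min-C≺min-D minimal {xC} {xD} (_ , xC-min) (xD∈D , _) with toℕ xC <? toℕ xD
  ... | yes xC<xD = xC<xD
  ... | no  xC≮xD = contradiction (key-<lex τ σ xD earlier (τ-beg-< xD xD∈D)) (minimal τ τ-is-model)
    where
    earlier : ∀ w → toℕ w < toℕ xD → pos τ (beg w) ≤ pb w
    earlier w w<xD = τ-beg-≤ w (λ w∈C → <⇒≱ (<-≤-trans w<xD (≮⇒≥ xC≮xD)) (xC-min w w∈C))

mainTheorem7 : (n : ℕ) (G : Graph n) (σ : Positioning n) → IsCanonicalModel G σ →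
    (X : Subset n) → IsClique G X →
    (s : ℕ) (C : Fin s → Subset n) →
    (∀ i → IsComponentOf G X (C i)) →
    (∀ i v → v ∈ C i → NbhdMinus≡ G v (C i) X) →
    (f l : Fin s → ℕ) →
    (∀ i → IsFirst σ (C i) (f i)) → (∀ i → IsLast σ (C i) (l i)) →
    (∀ i → f i < l i) →
    (∀ i j → toℕ j ≡ suc (toℕ i) → l i < f j) →
    (x : Fin s → Fin n) → (∀ i → IsMinOf (C i) (x i)) →
    ∀ i j → toℕ j ≡ suc (toℕ i) → toℕ (x i) < toℕ (x j)
mainTheorem7 _ G σ (σ-model , σ-minimal) X _ _ C C-comp C-nbhd _ _ C-first C-last _
             separated _ x-min i j j≡i+1 =
  Swap.min-C≺min-D G σ σ-model X (C i) (C j) (C-comp i) (C-comp j) (C-nbhd i) (C-nbhd j)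
                   (C-last i) (C-first j) (separated i j j≡i+1)
                   σ-minimal (x-min i) (x-min j)
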